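{- Let $q$ be a prime power, $n=tt'$ with integers $t,t'\ge2$, and let $f(x)=\sum_{i=0}^{n-1}a_ix^{q^i}\in\mathbb{F}_{q^n}[x]$ be R-$q^t$-partially scattered. For $\mathbf{a}=(a_0,\dots,a_{t'-1})\in\mathbb{F}_{q^n}^{t'}$ let $g_{\mathbf a}(x)=\sum_{i=0}^{t'-1}a_ix^{q^{it}}$. Then for every $\mathbf a\in\mathbb{F}_{q^n}^{t'}$, the $q$-polynomial $f(x)+g_{\mathbf a}(x)$ is R-$q^t$-partially scattered.
   Context: A $q$-polynomial $f$ over $\mathbb{F}_{q^n}$ is R-$q^t$-partially scattered if for all $y,z\in\mathbb{F}_{q^n}^*$, $f(y)/y=f(z)/z$ and $y/z\in\mathbb{F}_{q^t}$ imply $y/z\in\mathbb{F}_q$. -}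

module Defs where

open import Level using (Level; _⊔_; suc)
open import Data.Nat as ℕ using (ℕ; _≤_)
open import Data.Nat.Primality using (Prime)
open import Data.Fin using (Fin; toℕ)
open import Data.Product using (Σ; ∃; ∃₂; _×_)
open import Relation.Nullary using (¬_)
open import Relation.Binary.PropositionalEquality using (_≡_)
import Relation.Binary.PropositionalEquality as ≡
open import Function.Bundles using (Bijection)
open import Algebra.Bundles using (CommutativeRing)
import Algebra.Properties.Semiring.Exp as Exp
import Algebra.Properties.Monoid.Sum as Sum

IsPrimePower : ℕ → Set
IsPrimePower q = ∃₂ λ p k → Prime p × 1 ≤ k × q ≡ p ℕ.^ k

record Field (c ℓ : Level) : Set (Level.suc (c ⊔ ℓ)) where
  field
    commutativeRing : CommutativeRing c ℓ
  open CommutativeRing commutativeRing public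
  field
    0≉1     : ¬ (0# ≈ 1#)
    inverse : ∀ x → ¬ (x ≈ 0#) → ∃ λ y → x * y ≈ 1#

module _ {c ℓ : Level} (K : Field c ℓ) where
  open Field K
  open Exp semiring using (_^_)
  open Sum +-monoid using (sum)

  HasCardinality : ℕ → Set (c ⊔ ℓ)
  HasCardinality m = Bijection (≡.setoid (Fin m)) setoid

  InSubfield : (q s : ℕ) → Carrier → Set ℓ
  InSubfield q s x = x ^ (q ℕ.^ s) ≈ x

  qPoly : (q : ℕ) {n : ℕ} → (Fin n → Carrier) → Carrier → Carrier
  qPoly q a x = sum (λ i → a i * (x ^ (q ℕ.^ toℕ i)))

  gPoly : (q t : ℕ) {t' : ℕ} → (Fin t' → Carrier) → Carrier → Carrier
  gPoly q t a x = sum (λ i → a i * (x ^ (q ℕ.^ (toℕ i ℕ.* t))))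

  -- R-q^t-partially scattered: for all nonzero y, z,
  -- f(y)/y = f(z)/z and y/z ∈ F_{q^t} imply y/z ∈ F_q.
  -- f(y)/y = f(z)/z is written cross-multiplied: f(y) z = f(z) y (y,z ≠ 0);
  -- "y/z = w" is written y = w z.
  RPartiallyScattered : (q t : ℕ) → (Carrier → Carrier) → Set (c ⊔ ℓ)
  RPartiallyScattered q t f =
    ∀ y z → ¬ (y ≈ 0#) → ¬ (z ≈ 0#) →
    f y * z ≈ f z * y →
    (∀ w → y ≈ w * z → InSubfield q t w → InSubfield q 1 w)

-- For w ∈ F_{q^t} every exponent q^(it) fixes w, so g_a is
-- F_{q^t}-linear: g_a(wz) = w g_a(z).  Hence y = wz with w ∈ F_{q^t} gives
-- g_a(y)/y = g_a(z)/z, and adding g_a to f does not change which pairs (y, z)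
-- satisfy f(y)/y = f(z)/z.
module Submission where

open import Defs
open import Level using (Level; _⊔_)
open import Data.Nat using (ℕ; zero; suc; _≤_; _*_; _^_)
import Data.Nat as ℕ
open import Data.Nat.Properties using (^-distribˡ-+-*)
open import Data.Fin using (Fin; toℕ)
import Algebra.Properties.Semiring.Exp as Exp
import Algebra.Properties.CommutativeSemiring.Exp as CommExp
import Algebra.Properties.Semiring.Sum as SemiringSum
import Algebra.Properties.Monoid.Sum as MonoidSum
import Algebra.Properties.Group as GroupProperties
import Algebra.Properties.CommutativeSemigroup as CommSemigroupProperties
import Relation.Binary.Reasoning.Setoid as SetoidReasoning

module _ {c ℓ : Level} (K : Field c ℓ) (q t : ℕ) where
  open Field K renaming (_*_ to _·_)
  open Exp semiring using (^-congˡ; ^-congʳ; ^-assocʳ) renaming (_^_ to _^ᴷ_)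
  open CommExp commutativeSemiring using (^-distrib-*)
  open SemiringSum semiring using (*-distribˡ-sum)
  open MonoidSum +-monoid using (sum; sum-cong-≋)
  open GroupProperties +-group using (∙-cancelʳ)
  open CommSemigroupProperties *-commutativeSemigroup using (x∙yz≈y∙xz; xy∙z≈y∙xz)
  open SetoidReasoning setoid

  InSubfield-*ˡ : ∀ {w} i → InSubfield K q t w → InSubfield K q (i * t) w
  InSubfield-*ˡ     zero    _ = *-identityʳ _
  InSubfield-*ˡ {w} (suc i) w∈ = begin
    w ^ᴷ (q ^ (t ℕ.+ i * t))              ≈⟨ ^-congʳ w (^-distribˡ-+-* q t (i * t)) ⟩
    w ^ᴷ (q ^ t * q ^ (i * t))            ≈⟨ sym (^-assocʳ w (q ^ t) (q ^ (i * t))) ⟩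
    (w ^ᴷ (q ^ t)) ^ᴷ (q ^ (i * t))       ≈⟨ ^-congˡ (q ^ (i * t)) w∈ ⟩
    w ^ᴷ (q ^ (i * t))                    ≈⟨ InSubfield-*ˡ i w∈ ⟩
    w                                     ∎

  SubfieldLinear : (Carrier → Carrier) → Set (c ⊔ ℓ)
  SubfieldLinear h = ∀ w z → InSubfield K q t w → h (w · z) ≈ w · h z

  gPoly-cong : ∀ {t'} (b : Fin t' → Carrier) {u v} → u ≈ v →
               gPoly K q t b u ≈ gPoly K q t b v
  gPoly-cong {t'} b u≈v =
    sum-cong-≋ {t'} (λ i → *-congˡ (^-congˡ (q ^ (toℕ i * t)) u≈v))

  gPoly-subfieldLinear : ∀ {t'} (b : Fin t' → Carrier) → SubfieldLinear (gPoly K q t b)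
  gPoly-subfieldLinear {t'} b w z w∈ = begin
    gPoly K q t b (w · z)              ≈⟨ sum-cong-≋ {t'} monomial ⟩
    sum (λ i → w · (b i · z ^ᴷ e i))   ≈⟨ sym (*-distribˡ-sum {t'} w _) ⟩
    w · gPoly K q t b z                ∎
    where
    e : Fin t' → ℕ
    e i = q ^ (toℕ i * t)
    monomial : ∀ i → b i · (w · z) ^ᴷ e i ≈ w · (b i · z ^ᴷ e i)
    monomial i = begin
      b i · (w · z) ^ᴷ e i         ≈⟨ *-congˡ (^-distrib-* w z (e i)) ⟩
      b i · (w ^ᴷ e i · z ^ᴷ e i)  ≈⟨ *-congˡ (*-congʳ (InSubfield-*ˡ (toℕ i) w∈)) ⟩
      b i · (w · z ^ᴷ e i)         ≈⟨ x∙yz≈y∙xz (b i) w _ ⟩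
      w · (b i · z ^ᴷ e i)         ∎

  subfieldLinear-ratio : ∀ {h} → (∀ {u v} → u ≈ v → h u ≈ h v) →
                         SubfieldLinear h → ∀ {w y z} → InSubfield K q t w →
                         y ≈ w · z → h y · z ≈ h z · y
  subfieldLinear-ratio {h} h-cong h-lin {w} {y} {z} w∈ y≈wz = begin
    h y · z        ≈⟨ *-congʳ (h-cong y≈wz) ⟩
    h (w · z) · z  ≈⟨ *-congʳ (h-lin w z w∈) ⟩
    (w · h z) · z  ≈⟨ xy∙z≈y∙xz w (h z) z ⟩
    h z · (w · z)  ≈⟨ *-congˡ (sym y≈wz) ⟩
    h z · y        ∎

  RPartiallyScattered-+-subfieldLinear :
    ∀ {f h} → (∀ {u v} → u ≈ v → h u ≈ h v) → SubfieldLinear h →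
    RPartiallyScattered K q t f → RPartiallyScattered K q t (λ x → f x + h x)
  RPartiallyScattered-+-subfieldLinear {f = f} {h} h-cong h-lin f-scattered
    y z y≉0 z≉0 sum-ratio w y≈wz w∈ =
    f-scattered y z y≉0 z≉0 f-ratio w y≈wz w∈
    where
    h-ratio : h y · z ≈ h z · y
    h-ratio = subfieldLinear-ratio h-cong h-lin w∈ y≈wz
    f-ratio : f y · z ≈ f z · y
    f-ratio = ∙-cancelʳ (h y · z) (f y · z) (f z · y) (begin
      f y · z + h y · z  ≈⟨ sym (distribʳ z (f y) (h y)) ⟩
      (f y + h y) · z    ≈⟨ sum-ratio ⟩
      (f z + h z) · y    ≈⟨ distribʳ y (f z) (h z) ⟩
      f z · y + h z · y  ≈⟨ +-congˡ (sym h-ratio) ⟩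
      f z · y + h y · z  ∎)

proposition2p9 : {c ℓ : Level} (q t t' : ℕ) → IsPrimePower q → 2 ≤ t → 2 ≤ t' →
    (K : Field c ℓ) → HasCardinality K (q ^ (t * t')) →
    (a : Fin (t * t') → Field.Carrier K) →
    RPartiallyScattered K q t (qPoly K q a) →
    (b : Fin t' → Field.Carrier K) →
    RPartiallyScattered K q t (λ x → Field._+_ K (qPoly K q a x) (gPoly K q t b x))
proposition2p9 q t _ _ _ _ K _ _ f-scattered b =
  RPartiallyScattered-+-subfieldLinear K q t
    (gPoly-cong K q t b) (gPoly-subfieldLinear K q t b) f-scattered
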